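{- Let $\mathcal{P}$ be a smooth additive hypergraph property with $d(\mathcal{P})=r\ge1$, let $k\ge2$, and let $\delta=kr\ge3$. Let $L$ be a list-assignment for a hypergraph $H$ with $|L(v)|=k$ for all $v\in V(H)$, and let $H\ne K_{\delta+1}$ be locally linear with respect to $(\mathcal{P},L)$. Let $n=|H|$, $U=\{v\in V(H): d_H(v)=\delta\}$, $r_\delta=\delta-1+\frac{2}{\delta}$, and $\sigma=|U|\,r_\delta-d(H(U))$. If $\sigma\ge0$, then $$d(H)\ge a(\delta,n)=\delta n+\frac{\delta-2}{\delta^2+2\delta-2}\,n.$$
   Context: A hypergraph is a triple $H=(V,E,i)$ with $V,E$ finite and $i:E\to 2^V$, $|i(e)|\ge2$ (parallel edges allowed); $|H|=|V(H)|$; simple means no two distinct edges have the same vertex set. $H[X]$ is the induced subhypergraph on $X$, $H-v=H[V(H)\setminus\{v\}]$; the shrinking $H(X)$ has vertex set $X$, edges $\{e:|i(e)\cap X|\ge2\}$ and incidence $e\mapsto i(e)\cap X$. $d_H(v)$ is the number of edges containing $v$, $\delta(H)$ the minimum degree, and for any hypergraph $F$, $d(F)=\sum_{v\in V(F)}d_F(v)$. $K_n$ is the complete simple graph. A hypergraph property is an isomorphism-closed class; smooth: closed under induced subhypergraphs and containing a non-empty hypergraph but not all hypergraphs; additive: closed under vertex-disjoint unions. $\mathcal{F}(\mathcal{P})$ is the class of $H\notin\mathcal{P}$ with $H-v\in\mathcal{P}$ for all $v$; $d(\mathcal{P})=\min\{\delta(H):H\in\mathcal{F}(\mathcal{P})\}$.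 For $L:V(H)\to 2^C$, a $(\mathcal{P},L)$-coloring is $\varphi:V(H)\to C$ with $\varphi(v)\in L(v)$ and $H[\varphi^{ -1}(c)]\in\mathcal{P}$ for all $c$; $H$ is $(\mathcal{P},L)$-critical if it has none but every $H-v$ has one. With $r=d(\mathcal{P})$, $V(H,\mathcal{P},L)=\{v:d_H(v)=r|L(v)|\}$. $H$ is locally linear with respect to $(\mathcal{P},L)$ if $H$ is $(\mathcal{P},L)$-critical and $H(V(H,\mathcal{P},L))$ is simple. -}

module Defs where

open import Data.Nat as ℕ using (ℕ; _≤_; _+_; _*_; _∸_; _≡ᵇ_)
open import Data.Bool using (Bool; true; false; _∧_; if_then_else_)
open import Data.Fin as Fin using (Fin)
open import Data.Fin.Subset as S using (Subset; _∈_; _⊆_; _∩_; _─_; ⁅_⁆; ∣_∣; _∪_)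
open import Data.Fin.Subset.Properties using (_∈?_; _⊆?_)
open import Data.Vec as Vec using (Vec; tabulate; lookup)
open import Data.Nat.ListAction using (sum)
open import Data.List as List using (List; filter; map; length; allFin; concatMap; _++_)
open import Data.List.Relation.Unary.All using (All)
open import Data.List.Relation.Unary.Unique.Propositional using (Unique)
open import Data.List.Relation.Binary.Permutation.Propositional using (_↭_)
import Data.List.Membership.Propositional as LM
open import Data.Product using (Σ; ∃; _×_; _,_)
open import Relation.Binary.PropositionalEquality using (_≡_)
open import Relation.Nullary using (¬_)
open import Relation.Nullary.Decidable using (Dec)
open import Level using (Level; suc; _⊔_) renaming (zero to lzero)

-- A hypergraph is represented with vertex set a subset V
-- of some ambient Fin n, and its edges as a list of vertex sets
-- (a list, so parallel edges = repeated entries are allowed).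
-- The edge e has incidence set i(e) = the subset stored in the list.

record Hyp : Set where
  constructor hyp
  field
    n : ℕ
    V : Subset n
    E : List (Subset n)
open Hyp public

WF : Hyp → Set
WF H = All (λ e → e ⊆ V H × 2 ≤ ∣ e ∣) (E H)

order : Hyp → ℕ
order H = ∣ V H ∣

Simple : Hyp → Set
Simple H = Unique (E H)

induced : (H : Hyp) → Subset (n H) → Hyp
induced (hyp n V E) X = hyp n (X ∩ V) (filter (_⊆? (X ∩ V)) E)

del : (H : Hyp) → Fin (n H) → Hyp
del H v = induced H (V H ─ ⁅ v ⁆)

shrink : (H : Hyp) → Subset (n H) → Hyp
shrink (hyp n V E) X =
  hyp n (X ∩ V) (map (_∩ (X ∩ V)) (filter (λ e → 2 ℕ.≤? ∣ e ∩ (X ∩ V) ∣) E))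

deg : (H : Hyp) → Fin (n H) → ℕ
deg H v = length (filter (v ∈?_) (E H))

totdeg : Hyp → ℕ
totdeg H = sum (map (deg H) (filter (_∈? V H) (allFin (n H))))

MinDeg : Hyp → ℕ → Set
MinDeg H r = (∀ v → v ∈ V H → r ≤ deg H v) × (∃ λ v → v ∈ V H × deg H v ≡ r)

dunion : Hyp → Hyp → Hyp
dunion (hyp n₁ V₁ E₁) (hyp n₂ V₂ E₂) =
  hyp (n₁ + n₂) (V₁ Vec.++ V₂)
      (map (Vec._++ S.⊥) E₁ ++ map (S.⊥ Vec.++_) E₂)

Iso : Hyp → Hyp → Set
Iso (hyp n V E) (hyp n' V' E') =
  Σ (Fin n → Fin n') λ f → Σ (Fin n' → Fin n) λ g →
    (∀ v → v ∈ V → f v ∈ V') × (∀ w → w ∈ V' → g w ∈ V) ×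
    (∀ v → v ∈ V → g (f v) ≡ v) × (∀ w → w ∈ V' → f (g w) ≡ w) ×
    (E' ↭ map (λ e → tabulate (λ w → lookup e (g w)) ∩ V') E)

complete : ℕ → Hyp
complete m = hyp m S.⊤
  (concatMap (λ i → map (λ j → ⁅ i ⁆ ∪ ⁅ j ⁆) (filter (λ j → i Fin.<? j) (allFin m)))
             (allFin m))

Property : Set₁
Property = Hyp → Set

IsoClosed : Property → Set
IsoClosed P = ∀ H H' → WF H → WF H' → Iso H H' → P H → P H'

Smooth : Property → Set
Smooth P =
  (∀ H → WF H → P H → ∀ X → X ⊆ V H → P (induced H X)) ×
  (∃ λ H → WF H × S.Nonempty (V H) × P H) ×
  (∃ λ H → WF H × ¬ P H)

Additive : Property → Set
Additive P = ∀ H₁ H₂ → WF H₁ → WF H₂ → P H₁ → P H₂ → P (dunion H₁ H₂)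

InF : Property → Hyp → Set
InF P H = WF H × ¬ P H × (∀ v → v ∈ V H → P (del H v))

dP≡ : Property → ℕ → Set
dP≡ P r = (∀ H r' → InF P H → MinDeg H r' → r ≤ r')
        × (∃ λ H → InF P H × MinDeg H r)

ListAssignment : Hyp → Set
ListAssignment H = Fin (n H) → List ℕ

colourClass : (H : Hyp) → (Fin (n H) → ℕ) → ℕ → Subset (n H)
colourClass H φ c = tabulate (λ v → φ v ≡ᵇ c) ∩ V H

IsColouring : Property → (H : Hyp) → ListAssignment H → (Fin (n H) → ℕ) → Set
IsColouring P H L φ =
  (∀ v → v ∈ V H → φ v LM.∈ L v) × (∀ c → P (induced H (colourClass H φ c)))

Colourable : Property → (H : Hyp) → ListAssignment H → Set
Colourable P H L = ∃ λ φ → IsColouring P H L φ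

Critical : Property → (H : Hyp) → ListAssignment H → Set
Critical P H L = ¬ Colourable P H L × (∀ v → v ∈ V H → Colourable P (del H v) L)

-- V(H,P,L) = { v : d_H(v) = r |L(v)| }   (r = d(P))
lowSet : ℕ → (H : Hyp) → ListAssignment H → Subset (n H)
lowSet r H L = tabulate (λ v → deg H v ≡ᵇ r * length (L v)) ∩ V H

LocallyLinear : Property → ℕ → (H : Hyp) → ListAssignment H → Set
LocallyLinear P r H L = Critical P H L × Simple (shrink H (lowSet r H L))

degSet : (H : Hyp) → ℕ → Subset (n H)
degSet H δ = tabulate (λ v → deg H v ≡ᵇ δ) ∩ V H

module Submission where

-- Only two consequences of the hypotheses are used.
--  (1) Degree bound for critical hypergraphs: if H is (P,L)-critical, d(P) = r
--      and every list consists of k distinct colours, then d_H(v) ≥ k r = δ.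
--      For c ∈ L(v) extend a colouring of H - v by v ↦ c.  The colour class X_c
--      of v induces a non-P hypergraph, so it contains a set Y with H[Y] ∈ F(P);
--      then v ∈ Y and d_{H[Y]}(v) ≥ r, i.e. at least r edges through v lie in
--      X_c.  Edges found for different colours are different.  Since P is an
--      arbitrary predicate, the choice of Y is made under double negation,
--      which is harmless because the inequality sought is decidable.
--  (2) Double counting with U = {v : d(v) = δ}, W = V \ U, X = Σ_{w ∈ W} d(w):
--      d(H) = δ|U| + X,  |H| = |U| + |W|,  (δ+1)|W| ≤ X  (by (1)), and
--      δ|U| ≤ d(H(U)) + X, since an edge meeting U only once contains a vertex
--      of W.
-- With σ ≥ 0, i.e. δ d(H(U)) ≤ |U| (δ² - δ + 2), the claim is then a linear
-- inequality in |U|, |W| and X.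

open import Defs
open import Data.Nat as ℕ using (ℕ; zero; suc; _≤_; _+_; _*_; _∸_; z≤n; s≤s; _≤?_; _<?_; _≡ᵇ_)
open import Data.Nat.Properties
open import Data.Nat.Tactic.RingSolver using (solve-∀)
open import Data.Nat.ListAction using (sum)
open import Data.Bool using (true; false; if_then_else_)
open import Data.Bool.Properties using (T-≡)
open import Data.Empty using (⊥-elim)
open import Data.Fin as Fin using (Fin)
open import Data.Fin.Properties using (any?)
open import Data.Fin.Subset using (Subset; _∈_; _∉_; _⊆_; _∩_; _─_; ⁅_⁆; ∣_∣)
open import Data.Fin.Subset.Properties
  using (_∈?_; _⊆?_; x∈p∩q⁻; x∈p∩q⁺; ⊆-refl; ⊆-antisym; p─q⊆p; x∈p∧x≢y⇒x∈p-y; x∉⁅y⁆⇒x≢y;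
         x∈p⇒∣p-x∣<∣p∣; p⊆q⇒∣p∣≤∣q∣; ∣⁅x⁆∣≡1; x∈⁅x⁆)
open import Data.Vec using ([]; _∷_; tabulate; here; there)
open import Data.Vec.Properties using (lookup∘tabulate; []=⇒lookup; lookup⇒[]=)
open import Data.List using (List; []; _∷_; filter; map; length; allFin)
open import Data.List.Properties using (map-∘; map-tabulate)
open import Data.List.Relation.Unary.All as All using (All; []; _∷_)
open import Data.List.Relation.Unary.All.Properties using (all-filter; filter⁺)
open import Data.List.Relation.Unary.Any using (here; there)
open import Data.List.Relation.Unary.AllPairs using ([]; _∷_)
open import Data.List.Relation.Unary.Unique.Propositional using (Unique)
open import Data.List.Membership.Propositional using () renaming (_∈_ to _∈ˡ_)
open import Data.Product using (∃; _×_; _,_; proj₁; proj₂)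
open import Function using (id)
open import Function.Bundles using (Equivalence)
open import Relation.Binary.PropositionalEquality
open import Relation.Nullary using (¬_; Dec; yes; no; does)
open import Relation.Nullary.Decidable using (_×-dec_; ¬?; decidable-stable; ¬¬-excluded-middle)
open import Relation.Nullary.Negation using (DoubleNegation; ¬¬-map)
open import Relation.Unary using (Pred; Decidable)

∈∩⁻ : ∀ {n} {p q : Subset n} {x} → x ∈ p ∩ q → x ∈ p × x ∈ q
∈∩⁻ {p = p} {q} = x∈p∩q⁻ p q

∈∩⁺ : ∀ {n} {p q : Subset n} {x} → x ∈ p → x ∈ q → x ∈ p ∩ q
∈∩⁺ x∈p x∈q = x∈p∩q⁺ (x∈p , x∈q)

∈-remove⁻ : ∀ {n} {p : Subset n} {v x} → x ∈ p ─ ⁅ v ⁆ → x ∈ p × x ≢ v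
∈-remove⁻ {p = p} {v} x∈ = p─q⊆p p ⁅ v ⁆ x∈ , x∉⁅y⁆⇒x≢y (subtracted p ⁅ v ⁆ x∈)
  where
  subtracted : ∀ {n} (p q : Subset n) {x} → x ∈ p ─ q → x ∉ q
  subtracted (true ∷ p) (false ∷ q) here ()
  subtracted (_ ∷ p) (_ ∷ q) (there x∈) (there x∈q) = subtracted p q x∈ x∈q

other-element : ∀ {n} (e : Subset n) v → 2 ≤ ∣ e ∣ → ∃ λ u → u ∈ e × u ≢ v
other-element e v 2≤∣e∣ with any? (λ u → u ∈? e ×-dec ¬? (u Fin.≟ v))
... | yes found = found
... | no none = ⊥-elim (<⇒≱ 2≤∣e∣ (≤-trans (p⊆q⇒∣p∣≤∣q∣ e⊆⁅v⁆) (≤-reflexive (∣⁅x⁆∣≡1 v))))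
  where
  e⊆⁅v⁆ : e ⊆ ⁅ v ⁆
  e⊆⁅v⁆ {u} u∈e with u Fin.≟ v
  ... | yes refl = x∈⁅x⁆ v
  ... | no u≢v = ⊥-elim (none (u , u∈e , u≢v))

levelSet : ∀ {n} → (Fin n → ℕ) → ℕ → Subset n → Subset n
levelSet f c W = tabulate (λ v → f v ≡ᵇ c) ∩ W

levelSet⁻ : ∀ {n} (f : Fin n → ℕ) c W {v} → v ∈ levelSet f c W → f v ≡ c × v ∈ W
levelSet⁻ f c W {v} v∈ =
  ≡ᵇ⇒≡ (f v) c (Equivalence.from T-≡ (trans (sym (lookup∘tabulate _ v)) ([]=⇒lookup (proj₁ (∈∩⁻ v∈))))) ,
  proj₂ (∈∩⁻ v∈)

levelSet⁺ : ∀ {n} (f : Fin n → ℕ) c W {v} → f v ≡ c → v ∈ W → v ∈ levelSet f c W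
levelSet⁺ f c W {v} fv≡c v∈W =
  ∈∩⁺ (lookup⇒[]= v _ (trans (lookup∘tabulate _ v) (Equivalence.to T-≡ (≡⇒≡ᵇ (f v) c fv≡c)))) v∈W

induced-cong : ∀ (H : Hyp) {X Y : Subset (n H)} →
  X ∩ V H ⊆ Y ∩ V H → Y ∩ V H ⊆ X ∩ V H → induced H X ≡ induced H Y
induced-cong H X⊆Y Y⊆X = cong (λ S → hyp (n H) S (filter (_⊆? S) (E H))) (⊆-antisym X⊆Y Y⊆X)

filter-⊆-⊆ : ∀ {n} {S T : Subset n} → S ⊆ T → (es : List (Subset n)) →
  filter (_⊆? S) (filter (_⊆? T) es) ≡ filter (_⊆? S) es
filter-⊆-⊆ S⊆T [] = refl
filter-⊆-⊆ {S = S} {T} S⊆T (e ∷ es) with e ⊆? T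
... | yes _ with e ⊆? S
...   | yes _ = cong (e ∷_) (filter-⊆-⊆ S⊆T es)
...   | no _ = filter-⊆-⊆ S⊆T es
filter-⊆-⊆ {S = S} {T} S⊆T (e ∷ es) | no e⊈T with e ⊆? S
...   | yes e⊆S = ⊥-elim (e⊈T (λ x∈e → S⊆T (e⊆S x∈e)))
...   | no _ = filter-⊆-⊆ S⊆T es

induced-induced : ∀ (H : Hyp) (X Z : Subset (n H)) →
  induced (induced H X) Z ≡ induced H (Z ∩ (X ∩ V H))
induced-induced H X Z = trans
  (cong (hyp (n H) S) (filter-⊆-⊆ (λ x∈ → proj₂ (∈∩⁻ x∈)) (E H)))
  (cong (λ T → hyp (n H) T (filter (_⊆? T) (E H)))
        (⊆-antisym (λ x∈ → ∈∩⁺ x∈ (proj₂ (∈∩⁻ (proj₂ (∈∩⁻ x∈))))) (λ x∈ → proj₁ (∈∩⁻ x∈))))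
  where
  S : Subset (n H)
  S = Z ∩ (X ∩ V H)

del-induced : ∀ (H : Hyp) (Y : Subset (n H)) u → del (induced H Y) u ≡ induced H (Y ─ ⁅ u ⁆)
del-induced H Y u = trans (induced-induced H Y ((Y ∩ V H) ─ ⁅ u ⁆)) (induced-cong H forth back)
  where
  forth : ∀ {x} → x ∈ (((Y ∩ V H) ─ ⁅ u ⁆) ∩ (Y ∩ V H)) ∩ V H → x ∈ (Y ─ ⁅ u ⁆) ∩ V H
  forth x∈ with ∈-remove⁻ (proj₁ (∈∩⁻ (proj₁ (∈∩⁻ x∈))))
  ... | x∈Y∩V , x≢u = ∈∩⁺ (x∈p∧x≢y⇒x∈p-y (proj₁ (∈∩⁻ x∈Y∩V)) x≢u) (proj₂ (∈∩⁻ x∈))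
  back : ∀ {x} → x ∈ (Y ─ ⁅ u ⁆) ∩ V H → x ∈ (((Y ∩ V H) ─ ⁅ u ⁆) ∩ (Y ∩ V H)) ∩ V H
  back x∈ with ∈-remove⁻ (proj₁ (∈∩⁻ x∈)) | proj₂ (∈∩⁻ x∈)
  ... | x∈Y , x≢u | x∈V = ∈∩⁺ (∈∩⁺ (x∈p∧x≢y⇒x∈p-y (∈∩⁺ x∈Y x∈V) x≢u) (∈∩⁺ x∈Y x∈V)) x∈V

induced-WF : ∀ (H : Hyp) X → WF H → WF (induced H X)
induced-WF H X wf = All.zipWith (λ inside-edge → proj₁ inside-edge , proj₂ (proj₂ inside-edge))
  (all-filter (_⊆? (X ∩ V H)) (E H) , filter⁺ (_⊆? (X ∩ V H)) wf)

𝟙 : ∀ {a} {A : Set a} → Dec A → ℕ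
𝟙 d = if does d then 1 else 0

module _ {a} {A : Set a} where

  length-filter≡sum : ∀ {p} {P : Pred A p} (P? : Decidable P) xs →
    length (filter P? xs) ≡ sum (map (λ x → 𝟙 (P? x)) xs)
  length-filter≡sum P? [] = refl
  length-filter≡sum P? (x ∷ xs) with does (P? x)
  ... | true = cong suc (length-filter≡sum P? xs)
  ... | false = length-filter≡sum P? xs

  sum-filter : ∀ {p} {P : Pred A p} (P? : Decidable P) (f : A → ℕ) xs →
    sum (map f (filter P? xs)) ≡ sum (map (λ x → 𝟙 (P? x) * f x) xs)
  sum-filter P? f [] = refl
  sum-filter P? f (x ∷ xs) with does (P? x)
  ... | true = cong₂ _+_ (sym (+-identityʳ (f x))) (sum-filter P? f xs)
  ... | false = sum-filter P? f xs

  sum-+ : ∀ (f g : A → ℕ) xs → sum (map (λ x → f x + g x) xs) ≡ sum (map f xs) + sum (map g xs)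
  sum-+ f g [] = refl
  sum-+ f g (x ∷ xs) = trans (cong (f x + g x +_) (sum-+ f g xs))
                             (interchange (f x) (g x) (sum (map f xs)) (sum (map g xs)))
    where
    interchange : ∀ a b c d → a + b + (c + d) ≡ a + c + (b + d)
    interchange = solve-∀

  sum-*ˡ : ∀ c (f : A → ℕ) xs → sum (map (λ x → c * f x) xs) ≡ c * sum (map f xs)
  sum-*ˡ c f [] = sym (*-zeroʳ c)
  sum-*ˡ c f (x ∷ xs) = trans (cong (c * f x +_) (sum-*ˡ c f xs)) (sym (*-distribˡ-+ c (f x) _))

  sum-*ʳ : ∀ c (f : A → ℕ) xs → sum (map (λ x → f x * c) xs) ≡ sum (map f xs) * c
  sum-*ʳ c f [] = refl
  sum-*ʳ c f (x ∷ xs) = trans (cong (f x * c +_) (sum-*ʳ c f xs)) (sym (*-distribʳ-+ c (f x) _))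

  sum-cong : ∀ {f g : A → ℕ} → (∀ x → f x ≡ g x) → ∀ xs → sum (map f xs) ≡ sum (map g xs)
  sum-cong f≡g [] = refl
  sum-cong f≡g (x ∷ xs) = cong₂ _+_ (f≡g x) (sum-cong f≡g xs)

  sum-mono : ∀ {f g : A → ℕ} xs → All (λ x → f x ≤ g x) xs → sum (map f xs) ≤ sum (map g xs)
  sum-mono [] [] = z≤n
  sum-mono (x ∷ xs) (fx≤gx ∷ rest) = +-mono-≤ fx≤gx (sum-mono xs rest)

  length*≤sum : ∀ (f : A → ℕ) r (cs : List A) → (∀ c → c ∈ˡ cs → r ≤ f c) →
    length cs * r ≤ sum (map f cs)
  length*≤sum f r [] bound = z≤n
  length*≤sum f r (c ∷ cs) bound =
    +-mono-≤ (bound c (here refl)) (length*≤sum f r cs (λ c' c'∈ → bound c' (there c'∈)))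

  length-filter²-≤ : ∀ {G p q Q : A → Set} (p? : Decidable p) (q? : Decidable q) (Q? : Decidable Q) →
    (∀ x → G x → p x → q x → Q x) → ∀ xs → All G xs →
    length (filter p? (filter q? xs)) ≤ length (filter Q? xs)
  length-filter²-≤ p? q? Q? imp [] [] = z≤n
  length-filter²-≤ p? q? Q? imp (x ∷ xs) (gx ∷ gs) with q? x | Q? x
  ... | no _ | yes _ = ≤-trans (length-filter²-≤ p? q? Q? imp xs gs) (n≤1+n _)
  ... | no _ | no _ = length-filter²-≤ p? q? Q? imp xs gs
  ... | yes x∈q | Q?x with p? x | Q?x
  ...   | yes x∈p | yes _ = s≤s (length-filter²-≤ p? q? Q? imp xs gs)
  ...   | yes x∈p | no x∉Q = ⊥-elim (x∉Q (imp x gx x∈p x∈q))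
  ...   | no _ | yes _ = ≤-trans (length-filter²-≤ p? q? Q? imp xs gs) (n≤1+n _)
  ...   | no _ | no _ = length-filter²-≤ p? q? Q? imp xs gs

  length-filter-split : ∀ {Q R : A → Set} (Q? : Decidable Q) (R? : Decidable R) →
    (∀ x → Q x → R x) → ∀ xs →
    length (filter Q? xs) + length (filter (λ x → R? x ×-dec ¬? (Q? x)) xs) ≤ length (filter R? xs)
  length-filter-split Q? R? Q⇒R [] = z≤n
  length-filter-split Q? R? Q⇒R (x ∷ xs) with Q? x | R? x
  ... | yes _ | yes _ = s≤s (length-filter-split Q? R? Q⇒R xs)
  ... | yes Qx | no ¬Rx = ⊥-elim (¬Rx (Q⇒R x Qx))
  ... | no _ | yes _ = ≤-trans (≤-reflexive (+-suc _ _)) (s≤s (length-filter-split Q? R? Q⇒R xs))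
  ... | no _ | no _ = length-filter-split Q? R? Q⇒R xs

  sum-disjoint-counts : ∀ {C : Set} (Q : C → A → Set) (Q? : ∀ c → Decidable (Q c)) →
    (∀ c c' x → Q c x → Q c' x → c ≡ c') → (cs : List C) → Unique cs →
    (R : A → Set) (R? : Decidable R) → (∀ c x → c ∈ˡ cs → Q c x → R x) → ∀ xs →
    sum (map (λ c → length (filter (Q? c) xs)) cs) ≤ length (filter R? xs)
  sum-disjoint-counts Q Q? disjoint [] _ R R? Q⇒R xs = z≤n
  sum-disjoint-counts Q Q? disjoint (c₀ ∷ cs) (c₀∉cs ∷ unique) R R? Q⇒R xs =
    ≤-trans (+-monoʳ-≤ (length (filter (Q? c₀) xs))
              (sum-disjoint-counts Q Q? disjoint cs unique
                (λ x → R x × ¬ Q c₀ x) (λ x → R? x ×-dec ¬? (Q? c₀ x)) Q⇒R∖Q₀ xs))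
            (length-filter-split (Q? c₀) R? (λ x → Q⇒R c₀ x (here refl)) xs)
    where
    Q⇒R∖Q₀ : ∀ c x → c ∈ˡ cs → Q c x → R x × ¬ Q c₀ x
    Q⇒R∖Q₀ c x c∈ Qcx = Q⇒R c x (there c∈) Qcx , λ Q₀x → All.lookup c₀∉cs c∈ (disjoint c₀ c x Q₀x Qcx)

sum-swap : ∀ {a b} {A : Set a} {B : Set b} (h : A → B → ℕ) xs ys →
  sum (map (λ x → sum (map (h x) ys)) xs) ≡ sum (map (λ y → sum (map (λ x → h x y) xs)) ys)
sum-swap h [] ys = sym (sum-zeros ys)
  where
  sum-zeros : ∀ ys → sum (map (λ _ → 0) ys) ≡ 0
  sum-zeros [] = refl
  sum-zeros (_ ∷ ys) = sum-zeros ys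
sum-swap h (x ∷ xs) ys = trans (cong (sum (map (h x) ys) +_) (sum-swap h xs ys))
  (sym (sum-+ (h x) (λ y → sum (map (λ x → h x y) xs)) ys))

∑ : ∀ {n} → (Fin n → ℕ) → ℕ
∑ {n} f = sum (map f (allFin n))

∑-suc : ∀ {n} (f : Fin (suc n) → ℕ) → ∑ f ≡ f Fin.zero + ∑ (λ i → f (Fin.suc i))
∑-suc {n} f = cong (λ l → f Fin.zero + sum l)
  (trans (map-tabulate Fin.suc f) (sym (map-tabulate id (λ i → f (Fin.suc i)))))

∣p∣≡∑𝟙 : ∀ {n} (p : Subset n) → ∣ p ∣ ≡ ∑ (λ v → 𝟙 (v ∈? p))
∣p∣≡∑𝟙 {zero} [] = refl
∣p∣≡∑𝟙 {suc n} (b ∷ p) = trans (head b) (sym (∑-suc (λ v → 𝟙 (v ∈? (b ∷ p)))))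
  where
  head : ∀ b → ∣ b ∷ p ∣ ≡ 𝟙 (Fin.zero ∈? (b ∷ p)) + ∑ (λ v → 𝟙 (Fin.suc v ∈? (b ∷ p)))
  head true = cong suc (∣p∣≡∑𝟙 p)
  head false = ∣p∣≡∑𝟙 p

𝟙-idem : ∀ {a} {A : Set a} (d : Dec A) → 𝟙 d * 𝟙 d ≡ 𝟙 d
𝟙-idem (yes _) = refl
𝟙-idem (no _) = refl

𝟙-∩ : ∀ {n} v (p q : Subset n) → 𝟙 (v ∈? p ∩ q) ≡ 𝟙 (v ∈? p) * 𝟙 (v ∈? q)
𝟙-∩ v p q with v ∈? p ∩ q | v ∈? p | v ∈? q
... | yes _ | yes _ | yes _ = refl
... | yes v∈ | no v∉p | _ = ⊥-elim (v∉p (proj₁ (∈∩⁻ v∈)))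
... | yes v∈ | yes _ | no v∉q = ⊥-elim (v∉q (proj₂ (∈∩⁻ v∈)))
... | no v∉ | yes v∈p | yes v∈q = ⊥-elim (v∉ (∈∩⁺ v∈p v∈q))
... | no _ | yes _ | no _ = refl
... | no _ | no _ | _ = refl

weighted-handshake : ∀ (H : Hyp) (i : Fin (n H) → ℕ) →
  ∑ (λ v → i v * deg H v) ≡ sum (map (λ e → ∑ (λ v → i v * 𝟙 (v ∈? e))) (E H))
weighted-handshake H i = trans
  (sum-cong (λ v → trans (cong (i v *_) (length-filter≡sum (v ∈?_) (E H)))
                         (sym (sum-*ˡ (i v) (λ e → 𝟙 (v ∈? e)) (E H)))) (allFin (n H)))
  (sum-swap (λ v e → i v * 𝟙 (v ∈? e)) (allFin (n H)) (E H))

minimiser : ∀ {n} (f : Fin n → ℕ) (S : Subset n) {x} → x ∈ S →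
  ∃ λ m → m ∈ S × (∀ y → y ∈ S → f m ≤ f y)
minimiser f S {x} x∈S = descend (f x) x ≤-refl x∈S
  where
  descend : ∀ b x → f x ≤ b → x ∈ S → ∃ λ m → m ∈ S × (∀ y → y ∈ S → f m ≤ f y)
  descend b x fx≤b x∈S with any? (λ y → y ∈? S ×-dec f y <? f x)
  ... | no none = x , x∈S , λ y y∈S → ≮⇒≥ (λ fy<fx → none (y , y∈S , fy<fx))
  ... | yes (y , y∈S , fy<fx) with b
  ...   | zero = ⊥-elim (<⇒≱ fy<fx (≤-trans fx≤b z≤n))
  ...   | suc b' = descend b' y (≤-pred (≤-trans fy<fx fx≤b)) y∈S

F-degree : ∀ {P r} → dP≡ P r → ∀ G → InF P G → ∀ v → v ∈ V G → r ≤ deg G v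
F-degree dP G G∈F v v∈V with minimiser (deg G) (V G) v∈V
... | m , m∈V , m-min = ≤-trans (proj₁ dP G (deg G m) G∈F (m-min , m , m∈V , refl)) (m-min v v∈V)

MinimalNonP : Property → (H : Hyp) → Subset (n H) → Set
MinimalNonP P H Y = ¬ P (induced H Y) × (∀ u → u ∈ Y → P (induced H (Y ─ ⁅ u ⁆)))

minimalNonP∈F : ∀ P (H : Hyp) Y → WF H → MinimalNonP P H Y → InF P (induced H Y)
minimalNonP∈F P H Y wf (¬PY , PY-u) =
  induced-WF H Y wf , ¬PY , λ u u∈ → subst P (sym (del-induced H Y u)) (PY-u u (proj₁ (∈∩⁻ u∈)))

¬¬-case : ∀ {A B : Set} → (A → DoubleNegation B) → (¬ A → DoubleNegation B) → DoubleNegation B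
¬¬-case yes-case no-case ¬b = ¬¬-excluded-middle λ
  { (yes a) → yes-case a ¬b
  ; (no ¬a) → no-case ¬a ¬b }

¬¬-∀Fin : ∀ {n} {B : Fin n → Set} → (∀ i → DoubleNegation (B i)) → DoubleNegation (∀ i → B i)
¬¬-∀Fin {zero} _ ¬all = ¬all (λ ())
¬¬-∀Fin {suc n} each ¬all = each Fin.zero λ b₀ → ¬¬-∀Fin (λ i → each (Fin.suc i)) λ bs →
  ¬all λ { Fin.zero → b₀ ; (Fin.suc i) → bs i }

¬¬-→ : ∀ {A B : Set} → (A → DoubleNegation B) → DoubleNegation (A → B)
¬¬-→ f ¬ab = ¬ab (λ a → ⊥-elim (f a (λ b → ¬ab (λ _ → b))))

ContainsMinimalNonP : Property → (H : Hyp) → Subset (n H) → Set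
ContainsMinimalNonP P H X = ∃ λ Y → Y ⊆ X × MinimalNonP P H Y

ContainsMinimalNonP-mono : ∀ {P} {H : Hyp} {X Z} → X ⊆ Z → ContainsMinimalNonP P H X → ContainsMinimalNonP P H Z
ContainsMinimalNonP-mono X⊆Z (Y , Y⊆X , min) = Y , (λ y∈ → X⊆Z (Y⊆X y∈)) , min

-- Classically, every X with ¬ P(H[X]) contains a minimal non-P set: delete
-- vertices as long as P keeps failing.
¬¬-minimalNonP : ∀ P (H : Hyp) X → ¬ P (induced H X) → DoubleNegation (ContainsMinimalNonP P H X)
¬¬-minimalNonP P H X ¬PX = descend ∣ X ∣ X ≤-refl ¬PX
  where
  descend : ∀ b Y → ∣ Y ∣ ≤ b → ¬ P (induced H Y) → DoubleNegation (ContainsMinimalNonP P H Y)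
  descend b Y ∣Y∣≤b ¬PY = ¬¬-case (deeper b ∣Y∣≤b) minimal
    where
    minimal : ¬ (∃ λ u → u ∈ Y × ¬ P (induced H (Y ─ ⁅ u ⁆))) → DoubleNegation (ContainsMinimalNonP P H Y)
    minimal none = ¬¬-map {B = ContainsMinimalNonP P H Y} (λ PY-u → Y , ⊆-refl , ¬PY , PY-u)
      (¬¬-∀Fin λ u → ¬¬-→ λ u∈Y ¬PY-u → none (u , u∈Y , ¬PY-u))
    deeper : ∀ b → ∣ Y ∣ ≤ b → (∃ λ u → u ∈ Y × ¬ P (induced H (Y ─ ⁅ u ⁆))) →
      DoubleNegation (ContainsMinimalNonP P H Y)
    deeper zero ∣Y∣≤0 (u , u∈Y , _) = ⊥-elim (<⇒≱ (x∈p⇒∣p-x∣<∣p∣ u∈Y) (≤-trans ∣Y∣≤0 z≤n))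
    deeper (suc b) ∣Y∣≤b (u , u∈Y , ¬PY-u) =
      ¬¬-map (ContainsMinimalNonP-mono {P} {H} (λ x∈ → proj₁ (∈-remove⁻ x∈)))
        (descend b (Y ─ ⁅ u ⁆) (≤-pred (≤-trans (x∈p⇒∣p-x∣<∣p∣ u∈Y) ∣Y∣≤b)) ¬PY-u)

-- Step (1): the degree bound for critical hypergraphs.

module CriticalDegree (P : Property) (smooth : Smooth P) {r : ℕ} (dP : dP≡ P r)
  (H : Hyp) (wf : WF H) (L : ListAssignment H) (critical : Critical P H L) where

  -- Colour classes around a vertex v, relative to an L-colouring φ of H - v.
  module AroundVertex (v : Fin (n H)) (v∈V : v ∈ V H) where

    φ : Fin (n H) → ℕ
    φ = proj₁ (proj₂ critical v v∈V)

    φ-lists : ∀ u → u ∈ V (del H v) → φ u ∈ˡ L u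
    φ-lists = proj₁ (proj₂ (proj₂ critical v v∈V))

    oldClass : ℕ → Subset (n H)
    oldClass c = colourClass (del H v) φ c ∩ V (del H v)

    oldClass-P : ∀ c → P (induced H (oldClass c))
    oldClass-P c = subst P (induced-induced H (V H ─ ⁅ v ⁆) (colourClass (del H v) φ c))
                           (proj₂ (proj₂ (proj₂ critical v v∈V)) c)

    oldClass⁻ : ∀ c {u} → u ∈ oldClass c → φ u ≡ c × u ∈ V H × u ≢ v
    oldClass⁻ c u∈ with levelSet⁻ φ c (V (del H v)) (proj₁ (∈∩⁻ u∈))
    ... | φu≡c , u∈V-v = φu≡c , proj₂ (∈∩⁻ u∈V-v) , proj₂ (∈-remove⁻ (proj₁ (∈∩⁻ u∈V-v)))

    oldClass⁺ : ∀ c {u} → φ u ≡ c → u ∈ V H → u ≢ v → u ∈ oldClass c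
    oldClass⁺ c φu≡c u∈V u≢v = ∈∩⁺ (levelSet⁺ φ c (V (del H v)) φu≡c u∈V-v) u∈V-v
      where
      u∈V-v = ∈∩⁺ (x∈p∧x≢y⇒x∈p-y u∈V u≢v) u∈V

    extend : ℕ → Fin (n H) → ℕ
    extend c u with u Fin.≟ v
    ... | yes _ = c
    ... | no _ = φ u

    extend-v : ∀ c → extend c v ≡ c
    extend-v c with v Fin.≟ v
    ... | yes _ = refl
    ... | no v≢v = ⊥-elim (v≢v refl)

    extend-other : ∀ c u → u ≢ v → extend c u ≡ φ u
    extend-other c u u≢v with u Fin.≟ v
    ... | yes u≡v = ⊥-elim (u≢v u≡v)
    ... | no _ = refl

    newClass : ℕ → Subset (n H)
    newClass c = colourClass H (extend c) c

    extendedClass⇒oldClass : ∀ c c' {u} → u ∈ colourClass H (extend c) c' → u ≢ v → u ∈ oldClass c'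
    extendedClass⇒oldClass c c' {u} u∈ u≢v with levelSet⁻ (extend c) c' (V H) u∈
    ... | extend≡c' , u∈V = oldClass⁺ c' (trans (sym (extend-other c u u≢v)) extend≡c') u∈V u≢v

    otherClass : ∀ c c' → c' ≢ c → induced H (oldClass c') ≡ induced H (colourClass H (extend c) c')
    otherClass c c' c'≢c = induced-cong H forth back
      where
      forth : ∀ {x} → x ∈ oldClass c' ∩ V H → x ∈ colourClass H (extend c) c' ∩ V H
      forth {x} x∈ with oldClass⁻ c' (proj₁ (∈∩⁻ x∈))
      ... | φx≡c' , x∈V , x≢v =
        ∈∩⁺ (levelSet⁺ (extend c) c' (V H) (trans (extend-other c x x≢v) φx≡c') x∈V) x∈V
      back : ∀ {x} → x ∈ colourClass H (extend c) c' ∩ V H → x ∈ oldClass c' ∩ V H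
      back {x} x∈ with x Fin.≟ v
      ... | yes refl = ⊥-elim (c'≢c (trans (sym (proj₁ (levelSet⁻ (extend c) c' (V H) (proj₁ (∈∩⁻ x∈)))))
                                           (extend-v c)))
      ... | no x≢v = ∈∩⁺ (extendedClass⇒oldClass c c' (proj₁ (∈∩⁻ x∈)) x≢v) (proj₂ (∈∩⁻ x∈))

    -- H has no L-colouring, so for c ∈ L(v) the new class of c is not in P.
    newClass-not-P : ∀ c → c ∈ˡ L v → ¬ P (induced H (newClass c))
    newClass-not-P c c∈L P-newClass = proj₁ critical (extend c , lists , classes)
      where
      lists : ∀ u → u ∈ V H → extend c u ∈ˡ L u
      lists u u∈V with u Fin.≟ v
      ... | yes refl = c∈L
      ... | no u≢v = φ-lists u (∈∩⁺ (x∈p∧x≢y⇒x∈p-y u∈V u≢v) u∈V)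
      classes : ∀ c' → P (induced H (colourClass H (extend c) c'))
      classes c' with c' ℕ.≟ c
      ... | yes refl = P-newClass
      ... | no c'≢c = subst P (otherClass c c' c'≢c) (oldClass-P c')

    -- A part of the new class avoiding v lies in the old class, so P holds on it.
    avoiding-v-P : ∀ c Y → Y ⊆ newClass c → v ∉ Y → P (induced H Y)
    avoiding-v-P c Y Y⊆new v∉Y =
      subst P (trans (induced-induced H (oldClass c) Y) (induced-cong H forth back))
        (proj₁ smooth (induced H (oldClass c)) (induced-WF H (oldClass c) wf) (oldClass-P c) Y Y⊆old)
      where
      Y⊆old : Y ⊆ oldClass c ∩ V H
      Y⊆old x∈Y = ∈∩⁺ (extendedClass⇒oldClass c c (Y⊆new x∈Y) (λ { refl → v∉Y x∈Y }))
                      (proj₂ (levelSet⁻ (extend c) c (V H) (Y⊆new x∈Y)))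
      forth : ∀ {x} → x ∈ (Y ∩ (oldClass c ∩ V H)) ∩ V H → x ∈ Y ∩ V H
      forth x∈ = ∈∩⁺ (proj₁ (∈∩⁻ (proj₁ (∈∩⁻ x∈)))) (proj₂ (∈∩⁻ x∈))
      back : ∀ {x} → x ∈ Y ∩ V H → x ∈ (Y ∩ (oldClass c ∩ V H)) ∩ V H
      back x∈ = ∈∩⁺ (∈∩⁺ (proj₁ (∈∩⁻ x∈)) (Y⊆old (proj₁ (∈∩⁻ x∈)))) (proj₂ (∈∩⁻ x∈))

    EdgeIn : ℕ → Subset (n H) → Set
    EdgeIn c e = v ∈ e × e ⊆ newClass c × 2 ≤ ∣ e ∣

    EdgeIn? : ∀ c → Decidable (EdgeIn c)
    EdgeIn? c e = (v ∈? e) ×-dec (e ⊆? newClass c) ×-dec (2 ≤? ∣ e ∣)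

    edgesIn : ℕ → ℕ
    edgesIn c = length (filter (EdgeIn? c) (E H))

    -- At least r edges through v lie in the new class of each c ∈ L(v): a
    -- minimal non-P set Y inside it contains v, and H[Y] ∈ F(P) has d(v) ≥ r.
    edgesIn-bound : ∀ c → c ∈ˡ L v → r ≤ edgesIn c
    edgesIn-bound c c∈L = decidable-stable (r ≤? edgesIn c)
      (¬¬-map bound (¬¬-minimalNonP P H (newClass c) (newClass-not-P c c∈L)))
      where
      bound : ContainsMinimalNonP P H (newClass c) → r ≤ edgesIn c
      bound (Y , Y⊆new , minimal) with v ∈? Y
      ... | no v∉Y = ⊥-elim (proj₁ minimal (avoiding-v-P c Y Y⊆new v∉Y))
      ... | yes v∈Y = ≤-trans
        (F-degree dP (induced H Y) (minimalNonP∈F P H Y wf minimal) v (∈∩⁺ v∈Y v∈V))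
        (length-filter²-≤ (v ∈?_) (_⊆? (Y ∩ V H)) (EdgeIn? c)
          (λ e edge v∈e e⊆Y → v∈e , (λ x∈ → Y⊆new (proj₁ (∈∩⁻ (e⊆Y x∈))))  , proj₂ edge) (E H) wf)

    -- An edge through v in two new classes has a second vertex u, and φ(u) is
    -- both colours.
    edgesIn-disjoint : ∀ c c' e → EdgeIn c e → EdgeIn c' e → c ≡ c'
    edgesIn-disjoint c c' e (_ , e⊆c , 2≤∣e∣) (_ , e⊆c' , _) with other-element e v 2≤∣e∣
    ... | u , u∈e , u≢v = trans (sym (colour c e⊆c)) (colour c' e⊆c')
      where
      colour : ∀ c → e ⊆ newClass c → φ u ≡ c
      colour c e⊆ = trans (sym (extend-other c u u≢v)) (proj₁ (levelSet⁻ (extend c) c (V H) (e⊆ u∈e)))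

  critical-degree : ∀ k → (∀ v → v ∈ V H → length (L v) ≡ k × Unique (L v)) →
    ∀ v → v ∈ V H → k * r ≤ deg H v
  critical-degree k lists v v∈V with lists v v∈V
  ... | refl , distinct = ≤-trans (length*≤sum edgesIn r (L v) edgesIn-bound)
    (sum-disjoint-counts EdgeIn EdgeIn? edgesIn-disjoint (L v) distinct
      (v ∈_) (v ∈?_) (λ _ _ _ edge → proj₁ edge) (E H))
    where
    open AroundVertex v v∈V

-- Step (2): double counting around the set U of vertices of degree δ.

module DegreeCounting (H : Hyp) (δ : ℕ) where

  U : Subset (n H)
  U = degSet H δ

  U⁻ : ∀ {v} → v ∈ U → deg H v ≡ δ × v ∈ V H
  U⁻ = levelSet⁻ (deg H) δ (V H)

  iV iU iW : Fin (n H) → ℕ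
  iV v = 𝟙 (v ∈? V H)
  iU v = 𝟙 (v ∈? U)
  iW v = iV v ∸ iU v

  iU≤iV : ∀ v → iU v ≤ iV v
  iU≤iV v with v ∈? U | v ∈? V H
  ... | yes _ | yes _ = ≤-refl
  ... | yes v∈U | no v∉V = ⊥-elim (v∉V (proj₂ (U⁻ v∈U)))
  ... | no _ | _ = z≤n

  iU+iW : ∀ v → iU v + iW v ≡ iV v
  iU+iW v = m+[n∸m]≡n (iU≤iV v)

  iU-deg : ∀ v → iU v * δ ≡ iU v * deg H v
  iU-deg v with v ∈? U
  ... | yes v∈U = cong (1 *_) (sym (proj₁ (U⁻ v∈U)))
  ... | no _ = refl

  sizeW degW : ℕ
  sizeW = ∑ iW
  degW = ∑ (λ v → iW v * deg H v)

  ∑iU≡∣U∣ : ∑ iU ≡ ∣ U ∣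
  ∑iU≡∣U∣ = sym (∣p∣≡∑𝟙 U)

  degree-sum : totdeg H ≡ δ * ∣ U ∣ + degW
  degree-sum = begin
    totdeg H                                    ≡⟨ sum-filter (_∈? V H) (deg H) (allFin (n H)) ⟩
    ∑ (λ v → iV v * deg H v)                    ≡⟨ sum-cong split (allFin (n H)) ⟩
    ∑ (λ v → iU v * δ + iW v * deg H v)         ≡⟨ sum-+ (λ v → iU v * δ) (λ v → iW v * deg H v) (allFin (n H)) ⟩
    ∑ (λ v → iU v * δ) + degW                   ≡⟨ cong (_+ degW) (sum-*ʳ δ iU (allFin (n H))) ⟩
    ∑ iU * δ + degW                             ≡⟨ cong (λ m → m * δ + degW) ∑iU≡∣U∣ ⟩
    ∣ U ∣ * δ + degW                            ≡⟨ cong (_+ degW) (*-comm ∣ U ∣ δ) ⟩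
    δ * ∣ U ∣ + degW                            ∎
    where
    open ≡-Reasoning
    split : ∀ v → iV v * deg H v ≡ iU v * δ + iW v * deg H v
    split v = begin
      iV v * deg H v                  ≡⟨ cong (_* deg H v) (sym (iU+iW v)) ⟩
      (iU v + iW v) * deg H v         ≡⟨ *-distribʳ-+ (deg H v) (iU v) (iW v) ⟩
      iU v * deg H v + iW v * deg H v ≡⟨ cong (_+ iW v * deg H v) (sym (iU-deg v)) ⟩
      iU v * δ + iW v * deg H v       ∎

  order-split : order H ≡ ∣ U ∣ + sizeW
  order-split = begin
    order H                   ≡⟨ ∣p∣≡∑𝟙 (V H) ⟩
    ∑ iV                      ≡⟨ sum-cong (λ v → sym (iU+iW v)) (allFin (n H)) ⟩
    ∑ (λ v → iU v + iW v)     ≡⟨ sum-+ iU iW (allFin (n H)) ⟩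
    ∑ iU + sizeW              ≡⟨ cong (_+ sizeW) ∑iU≡∣U∣ ⟩
    ∣ U ∣ + sizeW             ∎
    where open ≡-Reasoning

  -- If δ is the minimum degree, vertices of W have degree at least δ + 1.
  sizeW-bound : (∀ v → v ∈ V H → δ ≤ deg H v) → (δ + 1) * sizeW ≤ degW
  sizeW-bound min-deg = begin
    (δ + 1) * sizeW            ≡⟨ *-comm (δ + 1) sizeW ⟩
    sizeW * (δ + 1)            ≡⟨ sum-*ʳ (δ + 1) iW (allFin (n H)) ⟨
    ∑ (λ v → iW v * (δ + 1))   ≤⟨ sum-mono (allFin (n H)) (All.universal W-deg (allFin (n H))) ⟩
    degW                       ∎
    where
    open ≤-Reasoning
    W-deg : ∀ v → iW v * (δ + 1) ≤ iW v * deg H v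
    W-deg v with v ∈? U | v ∈? V H
    ... | yes _ | yes _ = z≤n
    ... | yes _ | no _ = z≤n
    ... | no _ | no _ = z≤n
    ... | no v∉U | yes v∈V = +-monoˡ-≤ 0 (subst (_≤ deg H v) (+-comm 1 δ)
      (≤∧≢⇒< (min-deg v v∈V) (λ δ≡deg → v∉U (levelSet⁺ (deg H) δ (V H) (sym δ≡deg) v∈V))))

  Sh : Subset (n H)
  Sh = U ∩ V H

  cU cW : Subset (n H) → ℕ
  cU e = ∑ (λ v → iU v * 𝟙 (v ∈? e))
  cW e = ∑ (λ v → iW v * 𝟙 (v ∈? e))

  inU? : (e : Subset (n H)) → Dec (2 ≤ ∣ e ∩ Sh ∣)
  inU? e = 2 ≤? ∣ e ∩ Sh ∣

  𝟙-Sh : ∀ v → 𝟙 (v ∈? Sh) ≡ iU v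
  𝟙-Sh v with v ∈? Sh | v ∈? U
  ... | yes _ | yes _ = refl
  ... | yes v∈ | no v∉U = ⊥-elim (v∉U (proj₁ (∈∩⁻ v∈)))
  ... | no v∉ | yes v∈U = ⊥-elim (v∉ (∈∩⁺ v∈U (proj₂ (U⁻ v∈U))))
  ... | no _ | no _ = refl

  𝟙-∩Sh : ∀ v e → 𝟙 (v ∈? e ∩ Sh) ≡ iU v * 𝟙 (v ∈? e)
  𝟙-∩Sh v e = trans (𝟙-∩ v e Sh) (trans (cong (𝟙 (v ∈? e) *_) (𝟙-Sh v)) (*-comm (𝟙 (v ∈? e)) (iU v)))

  shrink-degree : totdeg (shrink H U) ≡ sum (map (λ e → 𝟙 (inU? e) * cU e) (E H))
  shrink-degree = begin
    totdeg (shrink H U)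
      ≡⟨ sum-filter (_∈? Sh) _ (allFin (n H)) ⟩
    ∑ (λ v → 𝟙 (v ∈? Sh) * length (filter (v ∈?_) (map (_∩ Sh) (filter inU? (E H)))))
      ≡⟨ sum-cong (λ v → cong (𝟙 (v ∈? Sh) *_) (shrink-deg v)) (allFin (n H)) ⟩
    ∑ (λ v → 𝟙 (v ∈? Sh) * sum (map (λ e → 𝟙 (inU? e) * 𝟙 (v ∈? e ∩ Sh)) (E H)))
      ≡⟨ sum-cong (λ v → trans (sym (sum-*ˡ (𝟙 (v ∈? Sh)) _ (E H))) (sum-cong (weight v) (E H))) (allFin (n H)) ⟩
    ∑ (λ v → sum (map (λ e → 𝟙 (inU? e) * (iU v * 𝟙 (v ∈? e))) (E H)))
      ≡⟨ sum-swap (λ v e → 𝟙 (inU? e) * (iU v * 𝟙 (v ∈? e))) (allFin (n H)) (E H) ⟩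
    sum (map (λ e → ∑ (λ v → 𝟙 (inU? e) * (iU v * 𝟙 (v ∈? e)))) (E H))
      ≡⟨ sum-cong (λ e → sum-*ˡ (𝟙 (inU? e)) _ (allFin (n H))) (E H) ⟩
    sum (map (λ e → 𝟙 (inU? e) * cU e) (E H)) ∎
    where
    open ≡-Reasoning
    shrink-deg : ∀ v → length (filter (v ∈?_) (map (_∩ Sh) (filter inU? (E H))))
                       ≡ sum (map (λ e → 𝟙 (inU? e) * 𝟙 (v ∈? e ∩ Sh)) (E H))
    shrink-deg v = begin
      length (filter (v ∈?_) (map (_∩ Sh) (filter inU? (E H))))
        ≡⟨ length-filter≡sum (v ∈?_) (map (_∩ Sh) (filter inU? (E H))) ⟩
      sum (map (λ e → 𝟙 (v ∈? e)) (map (_∩ Sh) (filter inU? (E H))))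
        ≡⟨ cong sum (map-∘ (filter inU? (E H))) ⟨
      sum (map (λ e → 𝟙 (v ∈? e ∩ Sh)) (filter inU? (E H)))
        ≡⟨ sum-filter inU? _ (E H) ⟩
      sum (map (λ e → 𝟙 (inU? e) * 𝟙 (v ∈? e ∩ Sh)) (E H)) ∎
    weight : ∀ v e → 𝟙 (v ∈? Sh) * (𝟙 (inU? e) * 𝟙 (v ∈? e ∩ Sh)) ≡ 𝟙 (inU? e) * (iU v * 𝟙 (v ∈? e))
    weight v e = begin
      𝟙 (v ∈? Sh) * (𝟙 (inU? e) * 𝟙 (v ∈? e ∩ Sh))  ≡⟨ cong₂ (λ a b → a * (𝟙 (inU? e) * b)) (𝟙-Sh v) (𝟙-∩Sh v e) ⟩
      iU v * (𝟙 (inU? e) * (iU v * 𝟙 (v ∈? e)))     ≡⟨ rearrange (iU v) (𝟙 (inU? e)) (𝟙 (v ∈? e)) ⟩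
      𝟙 (inU? e) * ((iU v * iU v) * 𝟙 (v ∈? e))     ≡⟨ cong (λ a → 𝟙 (inU? e) * (a * 𝟙 (v ∈? e))) (𝟙-idem (v ∈? U)) ⟩
      𝟙 (inU? e) * (iU v * 𝟙 (v ∈? e))              ∎
      where
      rearrange : ∀ a b x → a * (b * (a * x)) ≡ b * ((a * a) * x)
      rearrange = solve-∀

  ∣e∩Sh∣≡cU : ∀ e → ∣ e ∩ Sh ∣ ≡ cU e
  ∣e∩Sh∣≡cU e = trans (∣p∣≡∑𝟙 (e ∩ Sh)) (sum-cong (λ v → 𝟙-∩Sh v e) (allFin (n H)))

  cU+cW : ∀ e → e ⊆ V H → cU e + cW e ≡ ∣ e ∣
  cU+cW e e⊆V = begin
    cU e + cW e                                         ≡⟨ sum-+ _ _ (allFin (n H)) ⟨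
    ∑ (λ v → iU v * 𝟙 (v ∈? e) + iW v * 𝟙 (v ∈? e))     ≡⟨ sum-cong in-U-or-W (allFin (n H)) ⟩
    ∑ (λ v → 𝟙 (v ∈? e))                                ≡⟨ ∣p∣≡∑𝟙 e ⟨
    ∣ e ∣                                               ∎
    where
    open ≡-Reasoning
    in-U-or-W : ∀ v → iU v * 𝟙 (v ∈? e) + iW v * 𝟙 (v ∈? e) ≡ 𝟙 (v ∈? e)
    in-U-or-W v with v ∈? e | v ∈? U | v ∈? V H
    ... | _ | yes v∈U | no v∉V = ⊥-elim (v∉V (proj₂ (U⁻ v∈U)))
    ... | yes v∈e | no _ | no v∉V = ⊥-elim (v∉V (e⊆V v∈e))
    ... | yes _ | yes _ | yes _ = refl
    ... | yes _ | no _ | yes _ = refl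
    ... | no _ | yes _ | yes _ = refl
    ... | no _ | no _ | yes _ = refl
    ... | no _ | no _ | no _ = refl

  -- An edge meeting U at most once has a vertex in W:
  -- |e ∩ U| ≤ [e ∈ H(U)] |e ∩ U| + |e ∩ W|.
  edge-count : ∀ e → e ⊆ V H × 2 ≤ ∣ e ∣ → cU e ≤ 𝟙 (inU? e) * cU e + cW e
  edge-count e (e⊆V , 2≤∣e∣) = by-case (inU? e)
    where
    by-case : (d : Dec (2 ≤ ∣ e ∩ Sh ∣)) → cU e ≤ 𝟙 d * cU e + cW e
    by-case (yes _) = ≤-trans (≤-reflexive (sym (+-identityʳ (cU e)))) (m≤m+n (1 * cU e) (cW e))
    by-case (no ¬inU) = ≤-trans cU≤1 1≤cW
      where
      cU≤1 : cU e ≤ 1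
      cU≤1 = ≤-pred (≰⇒> (λ 2≤cU → ¬inU (subst (2 ≤_) (sym (∣e∩Sh∣≡cU e)) 2≤cU)))
      1≤cW : 1 ≤ cW e
      1≤cW = +-cancelˡ-≤ 1 1 (cW e)
        (≤-trans 2≤∣e∣ (≤-trans (≤-reflexive (sym (cU+cW e e⊆V))) (+-monoˡ-≤ (cW e) cU≤1)))

  U-bound : WF H → δ * ∣ U ∣ ≤ totdeg (shrink H U) + degW
  U-bound wf = begin
    δ * ∣ U ∣                     ≡⟨ *-comm δ ∣ U ∣ ⟩
    ∣ U ∣ * δ                     ≡⟨ cong (_* δ) ∑iU≡∣U∣ ⟨
    ∑ iU * δ                      ≡⟨ sum-*ʳ δ iU (allFin (n H)) ⟨
    ∑ (λ v → iU v * δ)            ≡⟨ sum-cong iU-deg (allFin (n H)) ⟩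
    ∑ (λ v → iU v * deg H v)      ≡⟨ weighted-handshake H iU ⟩
    sum (map cU (E H))            ≤⟨ sum-mono (E H) (All.map (λ {e} → edge-count e) wf) ⟩
    sum (map (λ e → 𝟙 (inU? e) * cU e + cW e) (E H))
                                  ≡⟨ sum-+ _ _ (E H) ⟩
    sum (map (λ e → 𝟙 (inU? e) * cU e) (E H)) + sum (map cW (E H))
                                  ≡⟨ cong₂ _+_ shrink-degree (weighted-handshake H iW) ⟨
    totdeg (shrink H U) + degW    ∎
    where open ≤-Reasoning

-- The bound for δ = 3 + t, where δ² + 2δ - 2 = t² + 8t + 13 and δ - 2 = 1 + t.
-- From δ²|U| ≤ δ d(H(U)) + δX ≤ |U|(δ² - δ + 2) + δX we get (δ - 2)|U| ≤ δX;
-- together with (δ + 1)|W| ≤ X this gives the claim, using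
-- (δ² + 2δ - 2)δ + (δ - 2) = (δ² + δ - 2)(δ + 1).
degree-sum-arith₃₊ : ∀ t u w x a →
  (3 + t) * u ≤ a + x →
  (3 + t) * a ≤ u * ((2 + t) * (3 + t) + 2) →
  (4 + t) * w ≤ x →
  (t * t + 8 * t + 13) * ((3 + t) * (u + w)) + (1 + t) * (u + w)
    ≤ (t * t + 8 * t + 13) * ((3 + t) * u + x)
degree-sum-arith₃₊ t u w x a δu≤a+x σ≥0 w-bound = begin
  D * ((3 + t) * (u + w)) + (1 + t) * (u + w)
    ≡⟨ expand-lhs t u w ⟩
  D * (3 + t) * u + ((t * t + 7 * t + 10) * ((4 + t) * w) + (1 + t) * u)
    ≤⟨ +-monoʳ-≤ (D * (3 + t) * u) (+-mono-≤ (*-monoʳ-≤ (t * t + 7 * t + 10) w-bound) u-bound) ⟩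
  D * (3 + t) * u + ((t * t + 7 * t + 10) * x + (3 + t) * x)
    ≡⟨ expand-rhs t u x ⟨
  D * ((3 + t) * u + x) ∎
  where
  open ≤-Reasoning
  D : ℕ
  D = t * t + 8 * t + 13
  expand-lhs : ∀ t u w → (t * t + 8 * t + 13) * ((3 + t) * (u + w)) + (1 + t) * (u + w)
    ≡ (t * t + 8 * t + 13) * (3 + t) * u + ((t * t + 7 * t + 10) * ((4 + t) * w) + (1 + t) * u)
  expand-lhs = solve-∀
  expand-rhs : ∀ t u x → (t * t + 8 * t + 13) * ((3 + t) * u + x)
    ≡ (t * t + 8 * t + 13) * (3 + t) * u + ((t * t + 7 * t + 10) * x + (3 + t) * x)
  expand-rhs = solve-∀
  square : ∀ t u → (3 + t) * ((3 + t) * u) ≡ u * ((2 + t) * (3 + t) + 2) + (1 + t) * u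
  square = solve-∀
  u-bound : (1 + t) * u ≤ (3 + t) * x
  u-bound = +-cancelˡ-≤ (u * ((2 + t) * (3 + t) + 2)) _ _ (begin
    u * ((2 + t) * (3 + t) + 2) + (1 + t) * u ≡⟨ square t u ⟨
    (3 + t) * ((3 + t) * u)                   ≤⟨ *-monoʳ-≤ (3 + t) δu≤a+x ⟩
    (3 + t) * (a + x)                         ≡⟨ *-distribˡ-+ (3 + t) a x ⟩
    (3 + t) * a + (3 + t) * x                 ≤⟨ +-monoˡ-≤ ((3 + t) * x) σ≥0 ⟩
    u * ((2 + t) * (3 + t) + 2) + (3 + t) * x ∎)

-- The bound in terms of δ ≥ 3, with u = |U|, w = |W|, x = X, a = d(H(U)),
-- T = d(H) and N = |H|.
degree-sum-arith : ∀ δ u w x a T N → 3 ≤ δ →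
  δ * u ≤ a + x →
  δ * a ≤ u * ((δ ∸ 1) * δ + 2) →
  (δ + 1) * w ≤ x →
  T ≡ δ * u + x → N ≡ u + w →
  (δ * δ + 2 * δ ∸ 2) * (δ * N) + (δ ∸ 2) * N ≤ (δ * δ + 2 * δ ∸ 2) * T
degree-sum-arith (suc (suc (suc t))) u w x a _ _ (s≤s (s≤s (s≤s _))) δu≤a+x σ≥0 w-bound refl refl =
  subst (λ D → D * ((3 + t) * (u + w)) + (1 + t) * (u + w) ≤ D * ((3 + t) * u + x))
    (sym (cong (_∸ 2) (square-form t)))
    (degree-sum-arith₃₊ t u w x a δu≤a+x σ≥0 (subst (λ d → d * w ≤ x) (+-comm (3 + t) 1) w-bound))
  where
  square-form : ∀ t → (3 + t) * (3 + t) + 2 * (3 + t) ≡ 2 + (t * t + 8 * t + 13)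
  square-form = solve-∀

lemma2p3 : (P : Property) → IsoClosed P → Smooth P → Additive P →
    (r k δ : ℕ) → dP≡ P r → 1 ≤ r → 2 ≤ k → δ ≡ k * r → 3 ≤ δ →
    (H : Hyp) → WF H → (L : ListAssignment H) →
    (∀ v → v ∈ V H → length (L v) ≡ k × Unique (L v)) →
    ¬ Iso H (complete (δ + 1)) →
    LocallyLinear P r H L →
    δ * totdeg (shrink H (degSet H δ)) ≤ ∣ degSet H δ ∣ * ((δ ∸ 1) * δ + 2) →
    (δ * δ + 2 * δ ∸ 2) * (δ * order H) + (δ ∸ 2) * order H
      ≤ (δ * δ + 2 * δ ∸ 2) * totdeg H
lemma2p3 P _ smooth _ r k δ dP _ _ δ≡kr 3≤δ H wf L lists _ (critical , _) σ≥0 =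
  degree-sum-arith δ ∣ U ∣ sizeW degW (totdeg (shrink H U)) (totdeg H) (order H) 3≤δ
    (U-bound wf) σ≥0 (sizeW-bound min-degree) degree-sum order-split
  where
  open DegreeCounting H δ
  min-degree : ∀ v → v ∈ V H → δ ≤ deg H v
  min-degree v v∈V = subst (_≤ deg H v) (sym δ≡kr)
    (CriticalDegree.critical-degree P smooth dP H wf L critical k lists v v∈V)
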